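{- Let $\{P_m(x,t)\}_{m\ge0}$ be the polynomials defined by $P_0=1$, $P_1=1-x$, and \[ P_m(x,t)=(1-x-x^2(t-1))P_{m-1}(x,t)-(x^2+x^3(t-1))P_{m-2}(x,t)\quad(m\ge2). \] Write $a=1-x-x^2(t-1)$ and $b=x^2+x^3(t-1)$. Then for $m\ge1$, \[ F_m^{\mathrm{asc}}(x,t)=\frac{P_m(x,t)}{P_{m+1}(x,t)}=\cfrac{1}{a-\cfrac{b}{a-\cfrac{b}{\ddots\, a-\cfrac{b}{1-x}}}}, \] a continued fraction in which $a$ appears $m$ times (i.e. with $m+1$ fraction bars), and \[ F^{\mathrm{asc}}(x,t)=\cfrac{1}{a-\cfrac{b}{a-\cfrac{b}{a-\cdots}}}=\frac{1-x-x^2(t-1)-\sqrt{1-2x-x^2(2t+1)-2x^3(t-1)+x^4(t-1)^2}}{2(x^2+x^3(t-1))}. \]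
   Context: A Motzkin path of length $n$ is a sequence of $n$ steps, each $U$ ($+1$), $F$ ($0$) or $D$ ($-1$), starting and ending at height $0$ and never going below height $0$; it has height bounded by $m$ if all its heights are at most $m$. An ascent of a Motzkin path is a maximal run of consecutive $U$ steps; $\mathrm{asc}\,\mu$ denotes the number of ascents of $\mu$. $\mathcal{M}_n^m$ is the set of Motzkin paths of length $n$ with height bounded by $m$ and $\mathcal{M}_n$ the set of all Motzkin paths of length $n$. $F_m^{\mathrm{asc}}(x,t)=\sum_{n\ge0}\sum_{\mu\in\mathcal{M}_n^m}t^{\mathrm{asc}\,\mu}x^n$ and $F^{\mathrm{asc}}(x,t)=\sum_{n\ge0}\sum_{\mu\in\mathcal{M}_n}t^{\mathrm{asc}\,\mu}x^n$. An infinite continued fraction denotes the formal power series limit of its finite truncations. -}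

module Defs where

open import Data.Nat as ℕ using (ℕ; zero; suc; _∸_; _≡ᵇ_; _≤ᵇ_)
open import Data.Integer as ℤ using (ℤ; +_; _+_; _*_; _-_; -_)
open import Data.Bool using (Bool; true; false; _∧_; if_then_else_)
open import Data.List using (List; []; _∷_; length; filter; concatMap; zipWith)
open import Data.List.Base using (upTo)
import Data.List as L
open import Relation.Binary.PropositionalEquality using (_≡_)
open import Relation.Nullary.Decidable using (Dec)
open import Data.Bool using (T)
open import Relation.Nullary.Decidable using (T?)

data Step : Set where
  U F D : Step

words : ℕ → List (List Step)
words zero    = [] ∷ []
words (suc n) = concatMap (λ w → (U ∷ w) ∷ (F ∷ w) ∷ (D ∷ w) ∷ []) (words n)

isMotzkinFrom : ℕ → List Step → Bool
isMotzkinFrom h       []      = h ≡ᵇ 0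
isMotzkinFrom h       (U ∷ w) = isMotzkinFrom (suc h) w
isMotzkinFrom h       (F ∷ w) = isMotzkinFrom h w
isMotzkinFrom zero    (D ∷ w) = false
isMotzkinFrom (suc h) (D ∷ w) = isMotzkinFrom h w

boundedFrom : ℕ → ℕ → List Step → Bool
boundedFrom m h       []      = h ≤ᵇ m
boundedFrom m h       (U ∷ w) = (h ≤ᵇ m) ∧ boundedFrom m (suc h) w
boundedFrom m h       (F ∷ w) = (h ≤ᵇ m) ∧ boundedFrom m h w
boundedFrom m zero    (D ∷ w) = (0 ≤ᵇ m) ∧ boundedFrom m zero w
boundedFrom m (suc h) (D ∷ w) = (suc h ≤ᵇ m) ∧ boundedFrom m h w

isMotzkin : List Step → Bool
isMotzkin = isMotzkinFrom 0

isMotzkinBounded : ℕ → List Step → Bool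
isMotzkinBounded m w = isMotzkin w ∧ boundedFrom m 0 w

-- number of ascents (maximal runs of U); the flag says whether the
-- previous step was U
ascFrom : Bool → List Step → ℕ
ascFrom _     []      = 0
ascFrom false (U ∷ w) = suc (ascFrom true w)
ascFrom true  (U ∷ w) = ascFrom true w
ascFrom _     (F ∷ w) = ascFrom false w
ascFrom _     (D ∷ w) = ascFrom false w

asc : List Step → ℕ
asc = ascFrom false

-- Formal power series in x and t with integer coefficients:
-- s n k is the coefficient of x^n t^k.

Series : Set
Series = ℕ → ℕ → ℤ

sumTo : ℕ → (ℕ → ℤ) → ℤ
sumTo zero    f = f 0
sumTo (suc n) f = sumTo n f + f (suc n)

_≈ₛ_ : Series → Series → Set
f ≈ₛ g = ∀ n k → f n k ≡ g n k

0ₛ 1ₛ xₛ tₛ : Series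
0ₛ _ _ = + 0
1ₛ n k = if (n ≡ᵇ 0) ∧ (k ≡ᵇ 0) then + 1 else + 0
xₛ n k = if (n ≡ᵇ 1) ∧ (k ≡ᵇ 0) then + 1 else + 0
tₛ n k = if (n ≡ᵇ 0) ∧ (k ≡ᵇ 1) then + 1 else + 0

_+ₛ_ _-ₛ_ _*ₛ_ : Series → Series → Series
(f +ₛ g) n k = f n k + g n k
(f -ₛ g) n k = f n k - g n k
(f *ₛ g) n k = sumTo n (λ i → sumTo k (λ j → f i j * g (n ∸ i) (k ∸ j)))

infixl 6 _+ₛ_ _-ₛ_
infixl 7 _*ₛ_
infix 4 _≈ₛ_

-- product in ℤ[[t]] (coefficient of t^k)
mulT : (ℕ → ℤ) → (ℕ → ℤ) → ℕ → ℤ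
mulT p q k = sumTo k (λ j → p j * q (k ∸ j))

oneT : ℕ → ℤ
oneT k = if k ≡ᵇ 0 then + 1 else + 0

-- invRev f n = [c_n, ..., c_0], the x-coefficients (elements of ℤ[[t]])
-- of the multiplicative inverse of f, for f whose x^0-coefficient is 1:
-- c_0 = 1, c_{n+1} = - Σ_{i=1}^{n+1} f_i c_{n+1-i}.
invRev : Series → ℕ → List (ℕ → ℤ)
invRev f zero    = oneT ∷ []
invRev f (suc n) = next ∷ prev
  where
  prev : List (ℕ → ℤ)
  prev = invRev f n
  terms : ℕ → List ℤ
  terms k = zipWith (λ i c → mulT (f i) c k) (L.map suc (upTo (suc n))) prev
  next : ℕ → ℤ
  next k = - L.foldr _+_ (+ 0) (terms k)

headT : List (ℕ → ℤ) → ℕ → ℤ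
headT []      _ = + 0
headT (c ∷ _) k = c k

-- multiplicative inverse of a series whose x^0-coefficient is 1
invₛ : Series → Series
invₛ f n k = headT (invRev f n) k

countAsc : (List Step → Bool) → ℕ → ℕ → ℕ
countAsc P n k = length (filter (λ w → T? (P w ∧ (asc w ≡ᵇ k))) (words n))

Fasc-bounded : ℕ → Series
Fasc-bounded m n k = + countAsc (isMotzkinBounded m) n k

Fasc : Series
Fasc n k = + countAsc isMotzkin n k

aₛ : Series
aₛ = 1ₛ -ₛ xₛ -ₛ xₛ *ₛ xₛ *ₛ (tₛ -ₛ 1ₛ)

bₛ : Series
bₛ = xₛ *ₛ xₛ +ₛ xₛ *ₛ xₛ *ₛ xₛ *ₛ (tₛ -ₛ 1ₛ)

Pₛ : ℕ → Series
Pₛ zero          = 1ₛ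
Pₛ (suc zero)    = 1ₛ -ₛ xₛ
Pₛ (suc (suc m)) = aₛ *ₛ Pₛ (suc m) -ₛ bₛ *ₛ Pₛ m

CF : ℕ → Series
CF zero    = invₛ (1ₛ -ₛ xₛ)
CF (suc m) = invₛ (aₛ -ₛ bₛ *ₛ CF m)

Δₛ : Series
Δₛ = 1ₛ -ₛ (xₛ +ₛ xₛ) -ₛ xₛ *ₛ xₛ *ₛ (tₛ +ₛ tₛ +ₛ 1ₛ)
     -ₛ (xₛ *ₛ xₛ *ₛ xₛ *ₛ (tₛ -ₛ 1ₛ) +ₛ xₛ *ₛ xₛ *ₛ xₛ *ₛ (tₛ -ₛ 1ₛ))
     +ₛ xₛ *ₛ xₛ *ₛ xₛ *ₛ xₛ *ₛ (tₛ -ₛ 1ₛ) *ₛ (tₛ -ₛ 1ₛ)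

ConvergesTo : (ℕ → Series) → Series → Set
ConvergesTo S G = ∀ N → Σ' N
  where
  open import Data.Product using (∃; _×_)
  Σ' : ℕ → Set
  Σ' N = ∃ λ M → ∀ m → M ℕ.≤ m → ∀ n → n ℕ.≤ N → ∀ k → S m n k ≡ G n k

module Submission where

-- Let Y(h,f) be the generating function of the words
--   that start at height h, stay within [0,m], end at height 0, weighted by
--   t^(ascents), where f records whether the preceding step was U.  Reading
--   off the first step gives a recurrence in the length which determines Y.
--   An explicit family built from P_j/P_{m+1} satisfies the same recurrence,
--   hence F_m^asc = Y(0,false) = P_m/P_{m+1}.
-- * Limit.  A word of length n ≤ m never rises above height m, so F_m^asc and
--   F^asc agree up to x^m.  This gives CF m → F^asc, and letting m → ∞ in
--   F_{m+1}(a - b F_m) = 1 gives F(a - b F) = 1; hence S = a - 2bF satisfies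
--   S² = a² - 4b = Δ, which is the closed form of F^asc.

open import Defs
open import Data.Nat using (ℕ; suc; _≤_)
open import Data.Integer using (+_)
open import Data.Product using (_×_; ∃; _,_)
open import Relation.Binary.PropositionalEquality using (_≡_)
open import Algebra.Bundles using (CommutativeRing)

module PowerSeriesRing {c ℓ} (R : CommutativeRing c ℓ) where
  open CommutativeRing R
  open import Data.Nat as ℕ using (zero; _∸_; z≤n)
  import Data.Nat.Properties as ℕₚ
  open import Data.Product using (_,_)
  import Relation.Binary.PropositionalEquality as Eq
  open import Relation.Binary using (IsEquivalence)
  open import Relation.Binary.Reasoning.Setoid setoid
  open import Algebra.Properties.CommutativeSemigroup +-commutativeSemigroup using (interchange)
  open import Algebra.Structures using (IsCommutativeRing)

  ∑ : ℕ → (ℕ → Carrier) → Carrier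
  ∑ zero    f = f 0
  ∑ (suc n) f = ∑ n f + f (suc n)

  ∑-cong≤ : ∀ n {f g} → (∀ i → i ≤ n → f i ≈ g i) → ∑ n f ≈ ∑ n g
  ∑-cong≤ zero    e = e 0 z≤n
  ∑-cong≤ (suc n) e = +-cong (∑-cong≤ n (λ i i≤n → e i (ℕₚ.m≤n⇒m≤1+n i≤n))) (e (suc n) ℕₚ.≤-refl)

  ∑-cong : ∀ n {f g} → (∀ i → f i ≈ g i) → ∑ n f ≈ ∑ n g
  ∑-cong n e = ∑-cong≤ n (λ i _ → e i)

  ∑-+ : ∀ n f g → ∑ n (λ i → f i + g i) ≈ ∑ n f + ∑ n g
  ∑-+ zero    f g = refl
  ∑-+ (suc n) f g = trans (+-cong (∑-+ n f g) refl) (interchange _ _ _ _)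

  ∑-*ˡ : ∀ n a f → a * ∑ n f ≈ ∑ n (λ i → a * f i)
  ∑-*ˡ zero    a f = refl
  ∑-*ˡ (suc n) a f = trans (distribˡ _ _ _) (+-cong (∑-*ˡ n a f) refl)

  ∑-*ʳ : ∀ n a f → ∑ n f * a ≈ ∑ n (λ i → f i * a)
  ∑-*ʳ zero    a f = refl
  ∑-*ʳ (suc n) a f = trans (distribʳ _ _ _) (+-cong (∑-*ʳ n a f) refl)

  ∑-zero : ∀ n {f} → (∀ i → f i ≈ 0#) → ∑ n f ≈ 0#
  ∑-zero zero    e = e 0
  ∑-zero (suc n) e = trans (+-cong (∑-zero n e) (e (suc n))) (+-identityˡ 0#)

  ∑-head : ∀ n f → ∑ (suc n) f ≈ f 0 + ∑ n (λ i → f (suc i))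
  ∑-head zero    f = refl
  ∑-head (suc n) f = trans (+-cong (∑-head n f) refl) (+-assoc _ _ _)

  ∑-reverse : ∀ n f → ∑ n f ≈ ∑ n (λ i → f (n ∸ i))
  ∑-reverse zero    f = refl
  ∑-reverse (suc n) f = begin
    ∑ (suc n) f                         ≈⟨ ∑-head n f ⟩
    f 0 + ∑ n (λ i → f (suc i))         ≈⟨ +-comm _ _ ⟩
    ∑ n (λ i → f (suc i)) + f 0         ≈⟨ +-cong (∑-reverse n (λ i → f (suc i))) refl ⟩
    ∑ n (λ i → f (suc (n ∸ i))) + f 0   ≈⟨ +-cong (∑-cong≤ n (λ i i≤n → reflexive (Eq.cong f (Eq.sym (ℕₚ.+-∸-assoc 1 i≤n))))) refl ⟩
    ∑ n (λ i → f (suc n ∸ i)) + f 0     ≈⟨ +-cong refl (reflexive (Eq.cong f (Eq.sym (ℕₚ.n∸n≡0 n)))) ⟩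
    ∑ n (λ i → f (suc n ∸ i)) + f (n ∸ n) ∎

  ∑-triangle : ∀ n (Φ : ℕ → ℕ → Carrier) →
    ∑ n (λ i → ∑ i (λ j → Φ j i)) ≈ ∑ n (λ j → ∑ (n ∸ j) (λ i → Φ j (j ℕ.+ i)))
  ∑-triangle zero    Φ = refl
  ∑-triangle (suc n) Φ = begin
    ∑ n (λ i → ∑ i (λ j → Φ j i)) + ∑ (suc n) (λ j → Φ j (suc n))
      ≈⟨ +-cong (∑-triangle n Φ) refl ⟩
    ∑ n Col + (∑ n (λ j → Φ j (suc n)) + Φ (suc n) (suc n))
      ≈⟨ sym (+-assoc _ _ _) ⟩
    (∑ n Col + ∑ n (λ j → Φ j (suc n))) + Φ (suc n) (suc n)
      ≈⟨ +-cong (sym (∑-+ n _ _)) (reflexive (Eq.cong (Φ (suc n)) (Eq.sym (ℕₚ.+-identityʳ (suc n))))) ⟩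
    ∑ n (λ j → Col j + Φ j (suc n)) + Φ (suc n) (suc n ℕ.+ 0)
      ≈⟨ +-cong (∑-cong≤ n extend-column) refl ⟩
    ∑ n (λ j → ∑ (suc n ∸ j) (λ i → Φ j (j ℕ.+ i))) + Φ (suc n) (suc n ℕ.+ 0)
      ≈⟨ +-cong refl (reflexive (Eq.cong (λ z → ∑ z (λ i → Φ (suc n) (suc n ℕ.+ i))) (Eq.sym (ℕₚ.n∸n≡0 n)))) ⟩
    ∑ n (λ j → ∑ (suc n ∸ j) (λ i → Φ j (j ℕ.+ i))) + ∑ (n ∸ n) (λ i → Φ (suc n) (suc n ℕ.+ i)) ∎
    where
    Col : ℕ → Carrier
    Col j = ∑ (n ∸ j) (λ i → Φ j (j ℕ.+ i))
    extend-column : ∀ j → j ≤ n → Col j + Φ j (suc n) ≈ ∑ (suc n ∸ j) (λ i → Φ j (j ℕ.+ i))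
    extend-column j j≤n rewrite ℕₚ.+-∸-assoc 1 j≤n =
      +-cong refl (reflexive (Eq.cong (Φ j) (Eq.sym (Eq.trans (ℕₚ.+-suc j (n ∸ j)) (Eq.cong suc (ℕₚ.m+[n∸m]≡n j≤n))))))

  PowerSeries : Set c
  PowerSeries = ℕ → Carrier

  infix 4 _≋_
  _≋_ : PowerSeries → PowerSeries → Set ℓ
  f ≋ g = ∀ n → f n ≈ g n

  infixl 6 _⊕_
  infixl 7 _⊛_
  _⊕_ _⊛_ : PowerSeries → PowerSeries → PowerSeries
  (f ⊕ g) n = f n + g n
  (f ⊛ g) n = ∑ n (λ i → f i * g (n ∸ i))

  ⊝_ : PowerSeries → PowerSeries
  (⊝ f) n = - f n

  𝟘 : PowerSeries
  𝟘 _ = 0#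

  const : Carrier → PowerSeries
  const r zero    = r
  const r (suc _) = 0#

  X : PowerSeries
  X zero          = 0#
  X (suc zero)    = 1#
  X (suc (suc _)) = 0#

  ⊛-cong : ∀ {f f' g g'} → f ≋ f' → g ≋ g' → f ⊛ g ≋ f' ⊛ g'
  ⊛-cong ef eg n = ∑-cong n (λ i → *-cong (ef i) (eg (n ∸ i)))

  ⊛-comm : ∀ f g → f ⊛ g ≋ g ⊛ f
  ⊛-comm f g n = trans (∑-reverse n _) (∑-cong≤ n (λ i i≤n →
    trans (*-comm _ _) (*-cong (reflexive (Eq.cong g (ℕₚ.m∸[m∸n]≡n i≤n))) refl)))

  const-⊛ : ∀ r g → const r ⊛ g ≋ (λ n → r * g n)
  const-⊛ r g zero    = refl
  const-⊛ r g (suc n) = trans (∑-head n _) (trans (+-cong refl (∑-zero n (λ i → zeroˡ _))) (+-identityʳ _))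

  X-⊛ : ∀ g → X ⊛ g ≋ (λ { zero → 0# ; (suc n) → g n })
  X-⊛ g zero    = zeroˡ _
  X-⊛ g (suc n) = begin
    ∑ (suc n) (λ i → X i * g (suc n ∸ i))               ≈⟨ ∑-head n _ ⟩
    0# * g (suc n) + ∑ n (λ i → X (suc i) * g (n ∸ i)) ≈⟨ +-cong (zeroˡ _) (pick n) ⟩
    0# + g n                                           ≈⟨ +-identityˡ _ ⟩
    g n ∎
    where
    pick : ∀ n → ∑ n (λ i → X (suc i) * g (n ∸ i)) ≈ g n
    pick zero    = *-identityˡ _
    pick (suc n) = trans (∑-head n _) (trans (+-cong (*-identityˡ _) (∑-zero n (λ i → zeroˡ _))) (+-identityʳ _))

  ⊛-distribˡ : ∀ f g h → f ⊛ (g ⊕ h) ≋ f ⊛ g ⊕ f ⊛ h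
  ⊛-distribˡ f g h n = trans (∑-cong n (λ i → distribˡ _ _ _)) (∑-+ n _ _)

  ⊛-assoc : ∀ f g h → (f ⊛ g) ⊛ h ≋ f ⊛ (g ⊛ h)
  ⊛-assoc f g h n = begin
    ∑ n (λ i → ∑ i (λ j → f j * g (i ∸ j)) * h (n ∸ i))
      ≈⟨ ∑-cong n (λ i → ∑-*ʳ i _ _) ⟩
    ∑ n (λ i → ∑ i (λ j → f j * g (i ∸ j) * h (n ∸ i)))
      ≈⟨ ∑-triangle n (λ j i → f j * g (i ∸ j) * h (n ∸ i)) ⟩
    ∑ n (λ j → ∑ (n ∸ j) (λ i → f j * g (j ℕ.+ i ∸ j) * h (n ∸ (j ℕ.+ i))))
      ≈⟨ ∑-cong n (λ j → ∑-cong (n ∸ j) (λ i → trans (*-assoc _ _ _)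
           (*-cong refl (*-cong (reflexive (Eq.cong g (ℕₚ.m+n∸m≡n j i)))
                                (reflexive (Eq.cong h (Eq.sym (ℕₚ.∸-+-assoc n j i)))))))) ⟩
    ∑ n (λ j → ∑ (n ∸ j) (λ i → f j * (g i * h (n ∸ j ∸ i))))
      ≈⟨ ∑-cong n (λ j → sym (∑-*ˡ (n ∸ j) _ _)) ⟩
    ∑ n (λ j → f j * ∑ (n ∸ j) (λ i → g i * h (n ∸ j ∸ i))) ∎

  ≋-isEquivalence : IsEquivalence _≋_
  ≋-isEquivalence = record
    { refl = λ _ → refl ; sym = λ e n → sym (e n) ; trans = λ e e' n → trans (e n) (e' n) }

  powerSeries-isCommutativeRing : IsCommutativeRing _≋_ _⊕_ _⊛_ ⊝_ 𝟘 (const 1#)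
  powerSeries-isCommutativeRing = record
    { isRing = record
      { +-isAbelianGroup = record
        { isGroup = record
          { isMonoid = record
            { isSemigroup = record
              { isMagma = record { isEquivalence = ≋-isEquivalence ; ∙-cong = λ e e' n → +-cong (e n) (e' n) }
              ; assoc = λ f g h n → +-assoc _ _ _ }
            ; identity = (λ f n → +-identityˡ _) , (λ f n → +-identityʳ _) }
          ; inverse = (λ f n → -‿inverseˡ _) , (λ f n → -‿inverseʳ _)
          ; ⁻¹-cong = λ e n → -‿cong (e n) }
        ; comm = λ f g n → +-comm _ _ }
      ; *-cong = ⊛-cong
      ; *-assoc = ⊛-assoc
      ; *-identity = one-⊛ , (λ f n → trans (⊛-comm f (const 1#) n) (one-⊛ f n))
      ; distrib = ⊛-distribˡ , (λ f g h n → trans (⊛-comm (g ⊕ h) f n)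
                    (trans (⊛-distribˡ f g h n) (+-cong (⊛-comm f g n) (⊛-comm f h n)))) }
    ; *-comm = ⊛-comm }
    where
    one-⊛ : ∀ f → const 1# ⊛ f ≋ f
    one-⊛ f n = trans (const-⊛ 1# f n) (*-identityˡ _)

  powerSeriesRing : CommutativeRing c ℓ
  powerSeriesRing = record { isCommutativeRing = powerSeries-isCommutativeRing }

module SeriesRing where
  open import Data.Nat as ℕ using (zero)
  open import Data.Integer as ℤ using (ℤ; _+_; _*_; -_)
  import Data.Integer.Properties as ℤₚ
  open import Data.Product using (_,_; proj₁; proj₂)
  open import Data.Bool using (if_then_else_; _∧_)
  open import Data.Maybe using (Maybe; just; nothing)
  open import Relation.Nullary using (yes; no)
  open import Algebra.Structures using (IsCommutativeRing)
  import Relation.Binary.PropositionalEquality as Eq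
  open Eq using (refl; cong; cong₂)

  module ℤ[[t]] = PowerSeriesRing ℤₚ.+-*-commutativeRing
  module ℤ[[t]][[x]] = PowerSeriesRing ℤ[[t]].powerSeriesRing

  sumTo-cong : ∀ n {f g} → (∀ i → f i ≡ g i) → sumTo n f ≡ sumTo n g
  sumTo-cong zero    e = e 0
  sumTo-cong (suc n) e = cong₂ _+_ (sumTo-cong n e) (e (suc n))

  sumTo≡∑ : ∀ n h → sumTo n h ≡ ℤ[[t]].∑ n h
  sumTo≡∑ zero    h = refl
  sumTo≡∑ (suc n) h = cong (_+ h (suc n)) (sumTo≡∑ n h)

  ∑-coeff : ∀ n (H : ℕ → ℕ → ℤ) k → ℤ[[t]][[x]].∑ n H k ≡ sumTo n (λ i → H i k)
  ∑-coeff zero    H k = refl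
  ∑-coeff (suc n) H k = cong (_+ H (suc n) k) (∑-coeff n H k)

  *ₛ≈⊛ : ∀ f g → f *ₛ g ≈ₛ f ℤ[[t]][[x]].⊛ g
  *ₛ≈⊛ f g n k = Eq.sym (Eq.trans (∑-coeff n _ k) (sumTo-cong n (λ i → Eq.sym (sumTo≡∑ k _))))

  negₛ : Series → Series
  negₛ f n k = - f n k

  ≈-refl : ∀ {f} → f ≈ₛ f
  ≈-refl _ _ = refl

  ≈-sym : ∀ {f g} → f ≈ₛ g → g ≈ₛ f
  ≈-sym e n k = Eq.sym (e n k)

  infixr 5 _⟨≈⟩_
  _⟨≈⟩_ : ∀ {f g h} → f ≈ₛ g → g ≈ₛ h → f ≈ₛ h
  (e ⟨≈⟩ e') n k = Eq.trans (e n k) (e' n k)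

  1ₛ≈1 : 1ₛ ≈ₛ ℤ[[t]][[x]].const (ℤ[[t]].const (+ 1))
  1ₛ≈1 zero    zero    = refl
  1ₛ≈1 zero    (suc k) = refl
  1ₛ≈1 (suc n) k       = refl

  series-isCommutativeRing : IsCommutativeRing _≈ₛ_ _+ₛ_ _*ₛ_ negₛ 0ₛ 1ₛ
  series-isCommutativeRing = record
    { isRing = record
      { +-isAbelianGroup = PS.+-isAbelianGroup
      ; *-cong = λ {f} {f'} {g} {g'} e e' → *ₛ≈⊛ f g ⟨≈⟩ ⊛-cong f f' g g' e e' ⟨≈⟩ ≈-sym (*ₛ≈⊛ f' g')
      ; *-assoc = λ f g h → *ₛ≈⊛ (f *ₛ g) h ⟨≈⟩ ⊛-cong _ _ h h (*ₛ≈⊛ f g) ≈-refl ⟨≈⟩ PS.*-assoc f g h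
                   ⟨≈⟩ ⊛-cong f f _ _ ≈-refl (≈-sym (*ₛ≈⊛ g h)) ⟨≈⟩ ≈-sym (*ₛ≈⊛ f (g *ₛ h))
      ; *-identity = (λ f → *ₛ≈⊛ 1ₛ f ⟨≈⟩ ⊛-cong _ _ f f 1ₛ≈1 ≈-refl ⟨≈⟩ proj₁ PS.*-identity f)
                   , (λ f → *ₛ≈⊛ f 1ₛ ⟨≈⟩ ⊛-cong f f _ _ ≈-refl 1ₛ≈1 ⟨≈⟩ proj₂ PS.*-identity f)
      ; distrib = (λ f g h → *ₛ≈⊛ f (g +ₛ h) ⟨≈⟩ proj₁ PS.distrib f g h ⟨≈⟩
                     (λ n k → cong₂ _+_ (Eq.sym (*ₛ≈⊛ f g n k)) (Eq.sym (*ₛ≈⊛ f h n k))))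
                , (λ f g h → *ₛ≈⊛ (g +ₛ h) f ⟨≈⟩ proj₂ PS.distrib f g h ⟨≈⟩
                     (λ n k → cong₂ _+_ (Eq.sym (*ₛ≈⊛ g f n k)) (Eq.sym (*ₛ≈⊛ h f n k))))
      }
    ; *-comm = λ f g → *ₛ≈⊛ f g ⟨≈⟩ PS.*-comm f g ⟨≈⟩ ≈-sym (*ₛ≈⊛ g f)
    }
    where
    module PS = IsCommutativeRing ℤ[[t]][[x]].powerSeries-isCommutativeRing
    ⊛-cong : ∀ f f' g g' → f ≈ₛ f' → g ≈ₛ g' → f ℤ[[t]][[x]].⊛ g ≈ₛ f' ℤ[[t]][[x]].⊛ g'
    ⊛-cong f f' g g' = ℤ[[t]][[x]].⊛-cong {f} {f'} {g} {g'}

  seriesRing : CommutativeRing _ _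
  seriesRing = record { isCommutativeRing = series-isCommutativeRing }

  open CommutativeRing seriesRing public using ()
    renaming (setoid to seriesSetoid; +-cong to +ₛ-cong; *-cong to *ₛ-cong)

  open import Algebra.Solver.Ring.AlmostCommutativeRing
    using (fromCommutativeRing; _-Raw-AlmostCommutative⟶_)

  ι : ℤ → Series
  ι c n k = if (n ℕ.≡ᵇ 0) ∧ (k ℕ.≡ᵇ 0) then c else + 0

  ι≈const : ∀ c → ι c ≈ₛ ℤ[[t]][[x]].const (ℤ[[t]].const c)
  ι≈const c zero    zero    = refl
  ι≈const c zero    (suc k) = refl
  ι≈const c (suc n) k       = refl

  ι-*-homo : ∀ c d → ι (c * d) ≈ₛ ι c *ₛ ι d
  ι-*-homo c d n k = Eq.sym (Eq.trans (*ₛ≈⊛ (ι c) (ι d) n k)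
    (Eq.trans (ℤ[[t]][[x]].⊛-cong {ι c} {_} {ι d} (ι≈const c) (ι≈const d) n k)
    (Eq.trans (ℤ[[t]][[x]].const-⊛ (ℤ[[t]].const c) (ℤ[[t]][[x]].const (ℤ[[t]].const d)) n k)
    (Eq.trans (constant-product n k) (Eq.sym (ι≈const (c * d) n k))))))
    where
    constant-product : ∀ n k → (ℤ[[t]].const c ℤ[[t]].⊛ ℤ[[t]][[x]].const (ℤ[[t]].const d) n) k
                              ≡ ℤ[[t]][[x]].const (ℤ[[t]].const (c * d)) n k
    constant-product zero    zero    = ℤ[[t]].const-⊛ c (ℤ[[t]].const d) 0
    constant-product zero    (suc k) = Eq.trans (ℤ[[t]].const-⊛ c (ℤ[[t]].const d) (suc k)) (ℤₚ.*-zeroʳ c)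
    constant-product (suc n) k       = Eq.trans (ℤ[[t]].const-⊛ c (λ _ → + 0) k) (ℤₚ.*-zeroʳ c)

  ι-morphism : CommutativeRing.rawRing ℤₚ.+-*-commutativeRing -Raw-AlmostCommutative⟶ fromCommutativeRing seriesRing
  ι-morphism = record
    { ⟦_⟧    = ι
    ; +-homo = λ { c d zero zero → refl ; c d zero (suc k) → refl ; c d (suc n) k → refl }
    ; *-homo = ι-*-homo
    ; -‿homo = λ { c zero zero → refl ; c zero (suc k) → refl ; c (suc n) k → refl }
    ; 0-homo = λ { zero zero → refl ; zero (suc k) → refl ; (suc n) k → refl }
    ; 1-homo = λ { zero zero → refl ; zero (suc k) → refl ; (suc n) k → refl }
    }

  ι-≟ : ∀ c d → Maybe (ι c ≈ₛ ι d)
  ι-≟ c d with c ℤ.≟ d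
  ... | yes refl = just ≈-refl
  ... | no _     = nothing

  open import Algebra.Solver.Ring (CommutativeRing.rawRing ℤₚ.+-*-commutativeRing)
    (fromCommutativeRing seriesRing) ι-morphism ι-≟ public

  ≈-modulo : ∀ {u} v w A B → u ≈ₛ v +ₛ w *ₛ (A -ₛ B) → A ≈ₛ B → u ≈ₛ v
  ≈-modulo {u} v w A B u≈ A≈B = begin
    u                    ≈⟨ u≈ ⟩
    v +ₛ w *ₛ (A -ₛ B)   ≈⟨ +ₛ-cong {v} {v} ≈-refl (*ₛ-cong {w} {w} ≈-refl (λ n k → cong (ℤ._- B n k) (A≈B n k))) ⟩
    v +ₛ w *ₛ (B -ₛ B)   ≈⟨ solve 3 (λ v w b → v :+ w :* (b :- b) := v) ≈-refl v w B ⟩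
    v ∎
    where open import Relation.Binary.Reasoning.Setoid seriesSetoid

  private
    x≈X : xₛ ≈ₛ ℤ[[t]][[x]].X
    x≈X zero          k       = refl
    x≈X (suc zero)    zero    = refl
    x≈X (suc zero)    (suc k) = refl
    x≈X (suc (suc n)) k       = refl

    t≈X : tₛ ≈ₛ ℤ[[t]][[x]].const ℤ[[t]].X
    t≈X zero    zero          = refl
    t≈X zero    (suc zero)    = refl
    t≈X zero    (suc (suc k)) = refl
    t≈X (suc n) zero          = refl
    t≈X (suc n) (suc k)       = refl

    x*-as-X : ∀ f n k → (xₛ *ₛ f) n k ≡ (ℤ[[t]][[x]].X ℤ[[t]][[x]].⊛ f) n k
    x*-as-X f n k = Eq.trans (*ₛ≈⊛ xₛ f n k) (ℤ[[t]][[x]].⊛-cong {xₛ} {_} {f} {f} x≈X ≈-refl n k)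

    t*-as-X : ∀ f n k → (tₛ *ₛ f) n k ≡ (ℤ[[t]].X ℤ[[t]].⊛ f n) k
    t*-as-X f n k = Eq.trans (*ₛ≈⊛ tₛ f n k) (Eq.trans (ℤ[[t]][[x]].⊛-cong {tₛ} {_} {f} {f} t≈X ≈-refl n k)
                              (ℤ[[t]][[x]].const-⊛ ℤ[[t]].X f n k))

  x*-zero : ∀ f k → (xₛ *ₛ f) 0 k ≡ + 0
  x*-zero f k = Eq.trans (x*-as-X f 0 k) (ℤ[[t]][[x]].X-⊛ f 0 k)

  x*-suc : ∀ f n k → (xₛ *ₛ f) (suc n) k ≡ f n k
  x*-suc f n k = Eq.trans (x*-as-X f (suc n) k) (ℤ[[t]][[x]].X-⊛ f (suc n) k)

  t*-zero : ∀ f n → (tₛ *ₛ f) n 0 ≡ + 0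
  t*-zero f n = Eq.trans (t*-as-X f n 0) (ℤ[[t]].X-⊛ (f n) 0)

  t*-suc : ∀ f n k → (tₛ *ₛ f) n (suc k) ≡ f n k
  t*-suc f n k = Eq.trans (t*-as-X f n (suc k)) (ℤ[[t]].X-⊛ (f n) (suc k))

module Inverse where
  open SeriesRing
  open import Data.Nat using (zero; _∸_)
  open import Data.Integer as ℤ using (ℤ; _+_; _-_; -_)
  import Data.Integer.Properties as ℤₚ
  open import Data.List as List using (List; _∷_; applyUpTo; zipWith; upTo)
  open import Function using (_∘_)
  import Relation.Binary.PropositionalEquality as Eq
  open Eq using (refl; cong; cong₂)

  ConstOne ConstZero : Series → Set
  ConstOne  f = ∀ k → f 0 k ≡ oneT k
  ConstZero f = ∀ k → f 0 k ≡ + 0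

  sumTo-head : ∀ n h → sumTo (suc n) h ≡ h 0 + sumTo n (λ i → h (suc i))
  sumTo-head n h = Eq.trans (sumTo≡∑ (suc n) h)
    (Eq.trans (ℤ[[t]].∑-head n h) (cong (λ z → h 0 + z) (Eq.sym (sumTo≡∑ n _))))

  sumTo-zero : ∀ n h → (∀ i → h i ≡ + 0) → sumTo n h ≡ + 0
  sumTo-zero zero    h e = e 0
  sumTo-zero (suc n) h e = cong₂ _+_ (sumTo-zero n h e) (e (suc n))

  mulT-oneT : ∀ p q → (∀ k → p k ≡ oneT k) → ∀ k → mulT p q k ≡ q k
  mulT-oneT p q p≡1 k = Eq.trans (sumTo≡∑ k _)
    (Eq.trans (ℤ[[t]].⊛-cong {p} {ℤ[[t]].const (+ 1)} {q} {q} (λ i → Eq.trans (p≡1 i) (oneT≡1 i)) (λ _ → refl) k)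
              (CommutativeRing.*-identityˡ ℤ[[t]].powerSeriesRing q k))
    where
    oneT≡1 : ∀ k → oneT k ≡ ℤ[[t]].const (+ 1) k
    oneT≡1 zero    = refl
    oneT≡1 (suc k) = refl

  ConstOne-* : ∀ f g → ConstOne f → ConstOne g → ConstOne (f *ₛ g)
  ConstOne-* f g f₀ g₀ k = Eq.trans (mulT-oneT (f 0) (g 0) f₀ k) (g₀ k)

  ConstOne-- : ∀ f g → ConstOne f → ConstZero g → ConstOne (f -ₛ g)
  ConstOne-- f g f₀ g₀ k = Eq.trans (cong₂ _-_ (f₀ k) (g₀ k)) (ℤₚ.+-identityʳ _)

  ConstZero-* : ∀ f g → ConstZero f → ConstZero (f *ₛ g)
  ConstZero-* f g f₀ k = sumTo-zero k _ (λ j → cong (ℤ._* g 0 (k ∸ j)) (f₀ j))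

  module _ (f : Series) where

    private
      c : ℕ → ℕ → ℤ
      c = invₛ f

    invRev-sum : ∀ n k (g : ℕ → ℕ) →
      List.foldr _+_ (+ 0) (zipWith (λ i d → mulT (f i) d k) (applyUpTo g (suc n)) (invRev f n))
        ≡ sumTo n (λ i → mulT (f (g i)) (c (n ∸ i)) k)
    invRev-sum zero    k g = ℤₚ.+-identityʳ _
    invRev-sum (suc n) k g = Eq.trans (cong (λ z → mulT (f (g 0)) (c (suc n)) k + z) (invRev-sum n k (g ∘ suc)))
                                      (Eq.sym (sumTo-head n (λ i → mulT (f (g i)) (c (suc n ∸ i)) k)))

    invₛ-inverse : ConstOne f → f *ₛ invₛ f ≈ₛ 1ₛ
    invₛ-inverse f₀ zero    k = mulT-oneT (f 0) oneT f₀ k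
    invₛ-inverse f₀ (suc n) k = begin
      sumTo (suc n) (λ i → mulT (f i) (c (suc n ∸ i)) k)
        ≡⟨ sumTo-head n _ ⟩
      mulT (f 0) (c (suc n)) k + sumTo n (λ i → mulT (f (suc i)) (c (n ∸ i)) k)
        ≡⟨ cong₂ _+_ (mulT-oneT (f 0) (c (suc n)) f₀ k) (Eq.sym tail≡) ⟩
      - tail + tail
        ≡⟨ ℤₚ.+-inverseˡ tail ⟩
      + 0 ∎
      where
      open Eq.≡-Reasoning
      tail : ℤ
      tail = List.foldr _+_ (+ 0) (zipWith (λ i d → mulT (f i) d k) (List.map suc (upTo (suc n))) (invRev f n))
      map-applyUpTo : ∀ {A B : Set} (h : A → B) (g : ℕ → A) n → List.map h (applyUpTo g n) ≡ applyUpTo (h ∘ g) n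
      map-applyUpTo h g zero    = refl
      map-applyUpTo h g (suc n) = cong (h (g 0) ∷_) (map-applyUpTo h (g ∘ suc) n)
      tail≡ : tail ≡ sumTo n (λ i → mulT (f (suc i)) (c (n ∸ i)) k)
      tail≡ = Eq.trans (cong (λ l → List.foldr _+_ (+ 0) (zipWith (λ i d → mulT (f i) d k) l (invRev f n)))
                              (map-applyUpTo suc (λ i → i) (suc n)))
                       (invRev-sum n k suc)

  invₛ-unique : ∀ g f → g *ₛ f ≈ₛ 1ₛ → ConstOne f → invₛ f ≈ₛ g
  invₛ-unique g f gf≈1 f₀ = begin
    invₛ f               ≈⟨ ≈-sym (*-identityˡ (invₛ f)) ⟩
    1ₛ *ₛ invₛ f         ≈⟨ *ₛ-cong {1ₛ} {g *ₛ f} {invₛ f} {invₛ f} (≈-sym gf≈1) ≈-refl ⟩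
    g *ₛ f *ₛ invₛ f     ≈⟨ *-assoc g f (invₛ f) ⟩
    g *ₛ (f *ₛ invₛ f)   ≈⟨ *ₛ-cong {g} {g} ≈-refl (invₛ-inverse f f₀) ⟩
    g *ₛ 1ₛ              ≈⟨ *-identityʳ g ⟩
    g ∎
    where
    open import Relation.Binary.Reasoning.Setoid seriesSetoid
    open CommutativeRing seriesRing using (*-identityˡ; *-identityʳ; *-assoc)

module ContinuedFraction where
  open SeriesRing
  open Inverse
  open import Data.Nat using (zero)
  open import Data.Integer using (_+_; _-_)
  import Data.Integer.Properties as ℤₚ
  import Relation.Binary.PropositionalEquality as Eq
  open Eq using (refl; cong; cong₂)
  open import Relation.Binary.Reasoning.Setoid seriesSetoid

  ConstZero-x : ConstZero xₛ
  ConstZero-x k = refl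

  ConstZero-b : ConstZero bₛ
  ConstZero-b k = cong₂ _+_ (ConstZero-* xₛ xₛ ConstZero-x k)
    (ConstZero-* (xₛ *ₛ xₛ *ₛ xₛ) (tₛ -ₛ 1ₛ) (ConstZero-* (xₛ *ₛ xₛ) xₛ (ConstZero-* xₛ xₛ ConstZero-x)) k)

  ConstOne-a : ConstOne aₛ
  ConstOne-a k = Eq.trans (cong (λ z → oneT k - + 0 - z)
                                (ConstZero-* (xₛ *ₛ xₛ) (tₛ -ₛ 1ₛ) (ConstZero-* xₛ xₛ ConstZero-x) k))
                          (Eq.trans (ℤₚ.+-identityʳ _) (ℤₚ.+-identityʳ _))

  ConstOne-a-bW : ∀ W → ConstOne (aₛ -ₛ bₛ *ₛ W)
  ConstOne-a-bW W = ConstOne-- aₛ (bₛ *ₛ W) ConstOne-a (ConstZero-* bₛ W ConstZero-b)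

  ConstOne-P : ∀ m → ConstOne (Pₛ m)
  ConstOne-P zero          k = refl
  ConstOne-P (suc zero)    k = ℤₚ.+-identityʳ _
  ConstOne-P (suc (suc m))   = ConstOne-- (aₛ *ₛ Pₛ (suc m)) (bₛ *ₛ Pₛ m)
    (ConstOne-* aₛ (Pₛ (suc m)) ConstOne-a (ConstOne-P (suc m))) (ConstZero-* bₛ (Pₛ m) ConstZero-b)

  P*invP : ∀ m → Pₛ m *ₛ invₛ (Pₛ m) ≈ₛ 1ₛ
  P*invP m = invₛ-inverse (Pₛ m) (ConstOne-P m)

  -- P_m / P_{m+1} = 1/(a - b P_{m-1}/P_m), using P_{m+1} = a P_m - b P_{m-1}
  quotient≈CF : ∀ m → Pₛ m *ₛ invₛ (Pₛ (suc m)) ≈ₛ CF m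
  quotient≈CF zero    = CommutativeRing.*-identityˡ seriesRing (invₛ (Pₛ 1))
  quotient≈CF (suc m) = ≈-sym (invₛ-unique (p₁ *ₛ i₂) (aₛ -ₛ bₛ *ₛ CF m) inverse (ConstOne-a-bW (CF m)))
    where
    p₀ p₁ i₁ i₂ : Series
    p₀ = Pₛ m
    p₁ = Pₛ (suc m)
    i₁ = invₛ (Pₛ (suc m))
    i₂ = invₛ (Pₛ (suc (suc m)))
    inverse : p₁ *ₛ i₂ *ₛ (aₛ -ₛ bₛ *ₛ CF m) ≈ₛ 1ₛ
    inverse = begin
      p₁ *ₛ i₂ *ₛ (aₛ -ₛ bₛ *ₛ CF m)
        ≈⟨ ≈-modulo (p₁ *ₛ i₂ *ₛ (aₛ -ₛ bₛ *ₛ (p₀ *ₛ i₁))) (negₛ (p₁ *ₛ i₂ *ₛ bₛ)) (CF m) (p₀ *ₛ i₁)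
             (solve 7 (λ a b c p₀ p₁ i₁ i₂ →
                p₁ :* i₂ :* (a :- b :* c)
                := p₁ :* i₂ :* (a :- b :* (p₀ :* i₁)) :+ (:- (p₁ :* i₂ :* b)) :* (c :- p₀ :* i₁))
                ≈-refl aₛ bₛ (CF m) p₀ p₁ i₁ i₂)
             (≈-sym (quotient≈CF m)) ⟩
      p₁ *ₛ i₂ *ₛ (aₛ -ₛ bₛ *ₛ (p₀ *ₛ i₁))
        ≈⟨ ≈-modulo (Pₛ (suc (suc m)) *ₛ i₂) (negₛ (bₛ *ₛ p₀ *ₛ i₂)) (p₁ *ₛ i₁) 1ₛ
             (solve 6 (λ a b p₀ p₁ i₁ i₂ →
                p₁ :* i₂ :* (a :- b :* (p₀ :* i₁))
                := (a :* p₁ :- b :* p₀) :* i₂ :+ (:- (b :* p₀ :* i₂)) :* (p₁ :* i₁ :- con (+ 1)))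
                ≈-refl aₛ bₛ p₀ p₁ i₁ i₂)
             (P*invP (suc m)) ⟩
      Pₛ (suc (suc m)) *ₛ i₂
        ≈⟨ P*invP (suc (suc m)) ⟩
      1ₛ ∎

-- A family Y h f (height h, flag f = "the previous
-- step was U") is determined by the recurrence obtained from the first step;
-- the recurrence is equivalent to a system of linear equations for the
-- series Y h f.
module TransferSystem where
  open SeriesRing
  open import Data.Nat as ℕ using (zero; _<_)
  import Data.Nat.Properties as ℕₚ
  open import Data.Integer using (_+_)
  import Data.Integer.Properties as ℤₚ
  open import Data.Bool using (Bool; true; false)
  open import Relation.Nullary using (yes; no)
  import Relation.Binary.PropositionalEquality as Eq
  open Eq using (refl; cong; cong₂)
  open Eq.≡-Reasoning

  Family : Set
  Family = ℕ → Bool → Series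

  -- the words of length 0 from height h
  δ : ℕ → Series
  δ zero    = 1ₛ
  δ (suc _) = 0ₛ

  -- a first step U starts a new ascent (factor t) unless the previous step was U
  up : Bool → Series → Series
  up true  Z = Z
  up false Z = tₛ *ₛ Z

  -- a first step D is possible only above height 0
  down : ℕ → Family → Series
  down zero    Y = 0ₛ
  down (suc h) Y = Y h false

  record Recurrence (m : ℕ) (Y : Family) : Set where
    field
      vanish  : ∀ h f n k → m < h → Y h f n k ≡ + 0
      initial : ∀ h f k → h ≤ m → Y h f 0 k ≡ δ h 0 k
      step    : ∀ h f n k → h ≤ m →
                Y h f (suc n) k ≡ up f (Y (suc h) true) n k + Y h false n k + down h Y n k

  recurrence-unique : ∀ {m Y Y'} → Recurrence m Y → Recurrence m Y' → ∀ n h f k → Y h f n k ≡ Y' h f n k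
  recurrence-unique {m} {Y} {Y'} R R' n h f k with h ℕ.≤? m
  ... | no h≰m = Eq.trans (Recurrence.vanish R h f n k (ℕₚ.≰⇒> h≰m)) (Eq.sym (Recurrence.vanish R' h f n k (ℕₚ.≰⇒> h≰m)))
  recurrence-unique {m} {Y} {Y'} R R' zero    h f k | yes h≤m =
    Eq.trans (Recurrence.initial R h f k h≤m) (Eq.sym (Recurrence.initial R' h f k h≤m))
  recurrence-unique {m} {Y} {Y'} R R' (suc n) h f k | yes h≤m = begin
    Y h f (suc n) k
      ≡⟨ Recurrence.step R h f n k h≤m ⟩
    up f (Y (suc h) true) n k + Y h false n k + down h Y n k
      ≡⟨ cong₂ (λ u d → u + Y h false n k + d) (up-agrees f k) (down-agrees h) ⟩
    up f (Y' (suc h) true) n k + Y h false n k + down h Y' n k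
      ≡⟨ cong (λ z → up f (Y' (suc h) true) n k + z + down h Y' n k) (IH h false k) ⟩
    up f (Y' (suc h) true) n k + Y' h false n k + down h Y' n k
      ≡⟨ Eq.sym (Recurrence.step R' h f n k h≤m) ⟩
    Y' h f (suc n) k ∎
    where
    IH : ∀ h f k → Y h f n k ≡ Y' h f n k
    IH = recurrence-unique R R' n
    up-agrees : ∀ f k → up f (Y (suc h) true) n k ≡ up f (Y' (suc h) true) n k
    up-agrees true  k       = IH (suc h) true k
    up-agrees false zero    = Eq.trans (t*-zero (Y (suc h) true) n) (Eq.sym (t*-zero (Y' (suc h) true) n))
    up-agrees false (suc k) = Eq.trans (t*-suc (Y (suc h) true) n k) (Eq.trans (IH (suc h) true k) (Eq.sym (t*-suc (Y' (suc h) true) n k)))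
    down-agrees : ∀ h → down h Y n k ≡ down h Y' n k
    down-agrees zero    = refl
    down-agrees (suc h) = IH h false k

  record Equations (m : ℕ) (Y : Family) : Set where
    field
      vanish   : ∀ h f n k → m < h → Y h f n k ≡ + 0
      equation : ∀ h f → h ≤ m →
                 Y h f ≈ₛ δ h +ₛ xₛ *ₛ up f (Y (suc h) true) +ₛ xₛ *ₛ Y h false +ₛ xₛ *ₛ down h Y

  -- comparing coefficients of x⁰ and x^(n+1) in the equations
  equations⇒recurrence : ∀ {m Y} → Equations m Y → Recurrence m Y
  equations⇒recurrence {m} {Y} E = record
    { vanish = Equations.vanish E ; initial = initial ; step = step }
    where
    initial : ∀ h f k → h ≤ m → Y h f 0 k ≡ δ h 0 k
    initial h f k h≤m = begin
      Y h f 0 k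
        ≡⟨ Equations.equation E h f h≤m 0 k ⟩
      δ h 0 k + (xₛ *ₛ up f (Y (suc h) true)) 0 k + (xₛ *ₛ Y h false) 0 k + (xₛ *ₛ down h Y) 0 k
        ≡⟨ cong₂ (λ u d → δ h 0 k + u + (xₛ *ₛ Y h false) 0 k + d) (x*-zero (up f (Y (suc h) true)) k) (x*-zero (down h Y) k) ⟩
      δ h 0 k + + 0 + (xₛ *ₛ Y h false) 0 k + + 0
        ≡⟨ cong (λ z → δ h 0 k + + 0 + z + + 0) (x*-zero (Y h false) k) ⟩
      δ h 0 k + + 0 + + 0 + + 0
        ≡⟨ Eq.trans (ℤₚ.+-identityʳ _) (Eq.trans (ℤₚ.+-identityʳ _) (ℤₚ.+-identityʳ _)) ⟩
      δ h 0 k ∎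
    δ-suc : ∀ h n k → δ h (suc n) k ≡ + 0
    δ-suc zero    n k = refl
    δ-suc (suc h) n k = refl
    step : ∀ h f n k → h ≤ m → Y h f (suc n) k ≡ up f (Y (suc h) true) n k + Y h false n k + down h Y n k
    step h f n k h≤m = begin
      Y h f (suc n) k
        ≡⟨ Equations.equation E h f h≤m (suc n) k ⟩
      δ h (suc n) k + (xₛ *ₛ up f (Y (suc h) true)) (suc n) k + (xₛ *ₛ Y h false) (suc n) k + (xₛ *ₛ down h Y) (suc n) k
        ≡⟨ cong₂ (λ d u → d + u + (xₛ *ₛ Y h false) (suc n) k + (xₛ *ₛ down h Y) (suc n) k) (δ-suc h n k) (x*-suc (up f (Y (suc h) true)) n k) ⟩
      + 0 + up f (Y (suc h) true) n k + (xₛ *ₛ Y h false) (suc n) k + (xₛ *ₛ down h Y) (suc n) k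
        ≡⟨ cong₂ (λ z d → + 0 + up f (Y (suc h) true) n k + z + d) (x*-suc (Y h false) n k) (x*-suc (down h Y) n k) ⟩
      + 0 + up f (Y (suc h) true) n k + Y h false n k + down h Y n k
        ≡⟨ cong (λ z → z + Y h false n k + down h Y n k) (ℤₚ.+-identityˡ (up f (Y (suc h) true) n k)) ⟩
      up f (Y (suc h) true) n k + Y h false n k + down h Y n k ∎

module Counting where
  open SeriesRing using (t*-zero; t*-suc)
  open TransferSystem
  open import Data.Nat as ℕ using (zero; _+_; _<_; _≤ᵇ_; _≡ᵇ_)
  import Data.Nat.Properties as ℕₚ
  import Data.Integer as ℤ
  import Data.Integer.Properties as ℤₚ
  open import Data.Bool using (Bool; true; false; _∧_; if_then_else_)
  open import Data.Bool.Properties using (T-≡; ∧-identityʳ; ∧-zeroʳ)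
  open import Data.Empty using (⊥-elim)
  open import Data.List using (List; []; _∷_; length; filter; concatMap)
  open import Function.Bundles using (Equivalence)
  open import Relation.Nullary.Decidable using (T?)
  import Relation.Binary.PropositionalEquality as Eq
  open Eq using (refl; cong; cong₂)
  open Eq.≡-Reasoning

  count : (List Step → Bool) → List (List Step) → ℕ
  count p []      = 0
  count p (w ∷ l) = (if p w then 1 else 0) + count p l

  length-filter≡count : ∀ p l → length (filter (λ w → T? (p w)) l) ≡ count p l
  length-filter≡count p []      = refl
  length-filter≡count p (w ∷ l) with p w
  ... | true  = cong suc (length-filter≡count p l)
  ... | false = length-filter≡count p l

  count-cong : ∀ {p q} l → (∀ w → p w ≡ q w) → count p l ≡ count q l
  count-cong []      e = refl
  count-cong (w ∷ l) e = cong₂ _+_ (cong (λ b → if b then 1 else 0) (e w)) (count-cong l e)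

  count-false : ∀ l → count (λ _ → false) l ≡ 0
  count-false []      = refl
  count-false (w ∷ l) = count-false l

  count-words : ∀ p n → count p (words (suc n)) ≡
    count (λ w → p (U ∷ w)) (words n) + count (λ w → p (F ∷ w)) (words n) + count (λ w → p (D ∷ w)) (words n)
  count-words p n = go (words n)
    where
    open import Data.Nat.Solver using (module +-*-Solver)
    open +-*-Solver using (solve; _:+_; _:=_)
    regroup : ∀ a b c x y z → a + (b + (c + (x + y + z))) ≡ (a + x) + (b + y) + (c + z)
    regroup = solve 6 (λ a b c x y z → a :+ (b :+ (c :+ (x :+ y :+ z))) := (a :+ x) :+ (b :+ y) :+ (c :+ z)) refl
    indicator : List Step → ℕ
    indicator w = if p w then 1 else 0
    go : ∀ l → count p (concatMap (λ w → (U ∷ w) ∷ (F ∷ w) ∷ (D ∷ w) ∷ []) l)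
             ≡ count (λ w → p (U ∷ w)) l + count (λ w → p (F ∷ w)) l + count (λ w → p (D ∷ w)) l
    go []      = refl
    go (w ∷ l) = Eq.trans (cong (λ z → indicator (U ∷ w) + (indicator (F ∷ w) + (indicator (D ∷ w) + z))) (go l))
                          (regroup (indicator (U ∷ w)) (indicator (F ∷ w)) (indicator (D ∷ w))
                                   (count (λ w → p (U ∷ w)) l) (count (λ w → p (F ∷ w)) l) (count (λ w → p (D ∷ w)) l))

  count-words-cong : ∀ n {p q} → (∀ w → length w ≡ n → p w ≡ q w) → count p (words n) ≡ count q (words n)
  count-words-cong zero    e = cong (λ b → (if b then 1 else 0) + 0) (e [] refl)
  count-words-cong (suc n) {p} {q} e =
    Eq.trans (count-words p n) (Eq.trans (cong₂ _+_ (cong₂ _+_ (after U) (after F)) (after D)) (Eq.sym (count-words q n)))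
    where
    after : ∀ s → count (λ w → p (s ∷ w)) (words n) ≡ count (λ w → q (s ∷ w)) (words n)
    after s = count-words-cong n (λ w ∣w∣≡n → e (s ∷ w) (cong suc ∣w∣≡n))

  ≤ᵇ-true : ∀ {h m} → h ≤ m → (h ≤ᵇ m) ≡ true
  ≤ᵇ-true h≤m = Equivalence.to T-≡ (ℕₚ.≤⇒≤ᵇ h≤m)

  ≤ᵇ-false : ∀ {h m} → m < h → (h ≤ᵇ m) ≡ false
  ≤ᵇ-false {h} {m} m<h with h ≤ᵇ m in eq
  ... | false = refl
  ... | true  = ⊥-elim (ℕₚ.<⇒≱ m<h (ℕₚ.≤ᵇ⇒≤ h m (Equivalence.from T-≡ eq)))

  below : ∀ {h m} → h ≤ m → ∀ b → ((h ≤ᵇ m) ∧ b) ≡ b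
  below h≤m b = cong (_∧ b) (≤ᵇ-true h≤m)

  bounded-above : ∀ {m h} w → m < h → boundedFrom m h w ≡ false
  bounded-above []      m<h = ≤ᵇ-false m<h
  bounded-above {m} {h}     (U ∷ w) m<h = cong (_∧ boundedFrom m (suc h) w) (≤ᵇ-false m<h)
  bounded-above {m} {h}     (F ∷ w) m<h = cong (_∧ boundedFrom m h w) (≤ᵇ-false m<h)
  bounded-above {m} {suc h} (D ∷ w) m<h = cong (_∧ boundedFrom m h w) (≤ᵇ-false m<h)

  bounded-short : ∀ {m h} w → h + length w ≤ m → boundedFrom m h w ≡ true
  bounded-short {m} {h} [] le = ≤ᵇ-true (Eq.subst (_≤ m) (ℕₚ.+-identityʳ h) le)
  bounded-short {m} {h} (U ∷ w) le = Eq.trans (below (ℕₚ.m+n≤o⇒m≤o h le) (boundedFrom m (suc h) w))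
    (bounded-short w (Eq.subst (_≤ m) (ℕₚ.+-suc h (length w)) le))
  bounded-short {m} {h} (F ∷ w) le = Eq.trans (below (ℕₚ.m+n≤o⇒m≤o h le) (boundedFrom m h w))
    (bounded-short w (ℕₚ.≤-trans (ℕₚ.+-monoʳ-≤ h (ℕₚ.n≤1+n _)) le))
  bounded-short {m} {zero} (D ∷ w) le = bounded-short w (ℕₚ.≤-trans (ℕₚ.n≤1+n _) le)
  bounded-short {m} {suc h} (D ∷ w) le = Eq.trans (below (ℕₚ.m+n≤o⇒m≤o (suc h) le) (boundedFrom m h w))
    (bounded-short w (ℕₚ.≤-trans (ℕₚ.+-monoʳ-≤ h (ℕₚ.n≤1+n _)) (ℕₚ.≤-trans (ℕₚ.n≤1+n _) le)))

  -- the words from height h with k ascents that stay within [0,m] and end at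
  -- height 0; f says whether the step preceding the word was U
  Walk : ℕ → ℕ → Bool → ℕ → List Step → Bool
  Walk m h f k w = (isMotzkinFrom h w ∧ boundedFrom m h w) ∧ (ascFrom f w ≡ᵇ k)

  walks : ℕ → Family
  walks m h f n k = ℤ.+ count (Walk m h f k) (words n)

  Fasc-bounded≈walks : ∀ m → Fasc-bounded m ≈ₛ walks m 0 false
  Fasc-bounded≈walks m n k = cong ℤ.+_ (length-filter≡count _ (words n))

  Fasc-bounded-short : ∀ m n k → n ≤ m → Fasc-bounded m n k ≡ Fasc n k
  Fasc-bounded-short m n k n≤m = cong ℤ.+_ (begin
    countAsc (isMotzkinBounded m) n k                          ≡⟨ length-filter≡count _ (words n) ⟩
    count (λ w → isMotzkinBounded m w ∧ (asc w ≡ᵇ k)) (words n) ≡⟨ count-words-cong n unbounded ⟩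
    count (λ w → isMotzkin w ∧ (asc w ≡ᵇ k)) (words n)          ≡⟨ Eq.sym (length-filter≡count _ (words n)) ⟩
    countAsc isMotzkin n k ∎)
    where
    unbounded : ∀ w → length w ≡ n → isMotzkinBounded m w ∧ (asc w ≡ᵇ k) ≡ isMotzkin w ∧ (asc w ≡ᵇ k)
    unbounded w ∣w∣≡n = cong (_∧ (asc w ≡ᵇ k))
      (Eq.trans (cong (isMotzkin w ∧_) (bounded-short w (Eq.subst (_≤ m) (Eq.sym ∣w∣≡n) n≤m))) (∧-identityʳ _))

  -- A first step U
  -- leads to height h+1 and starts a new ascent unless it was preceded by U;
  -- F and D end the current ascent, and D is impossible at height 0.
  first-U : ∀ {m h} → h ≤ m → ∀ f k n →
            ℤ.+ count (λ w → Walk m h f k (U ∷ w)) (words n) ≡ up f (walks m (suc h) true) n k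
  first-U {m} {h} h≤m true k n = cong ℤ.+_ (count-cong (words n) (λ w →
    cong (λ b → (isMotzkinFrom (suc h) w ∧ b) ∧ (ascFrom true w ≡ᵇ k)) (below h≤m (boundedFrom m (suc h) w))))
  first-U {m} {h} h≤m false zero n =
    Eq.trans (cong ℤ.+_ (Eq.trans (count-cong (words n) (λ w → ∧-zeroʳ _)) (count-false (words n))))
             (Eq.sym (t*-zero (walks m (suc h) true) n))
  first-U {m} {h} h≤m false (suc k) n = Eq.trans (first-U h≤m true k n) (Eq.sym (t*-suc (walks m (suc h) true) n k))

  first-F : ∀ {m h} → h ≤ m → ∀ f k n →
            count (λ w → Walk m h f k (F ∷ w)) (words n) ≡ count (Walk m h false k) (words n)
  first-F {m} {h} h≤m f k n = count-cong (words n) (λ w → Eq.trans (reset f w)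
    (cong (λ b → (isMotzkinFrom h w ∧ b) ∧ (ascFrom false w ≡ᵇ k)) (below h≤m (boundedFrom m h w))))
    where
    reset : ∀ f w → Walk m h f k (F ∷ w) ≡ Walk m h false k (F ∷ w)
    reset true  w = refl
    reset false w = refl

  first-D : ∀ {m} h → h ≤ m → ∀ f k n → ℤ.+ count (λ w → Walk m h f k (D ∷ w)) (words n) ≡ down h (walks m) n k
  first-D         zero    _   f k n = cong ℤ.+_ (count-false (words n))
  first-D {m} (suc h) h<m f k n = cong ℤ.+_ (count-cong (words n) (λ w → Eq.trans (reset f w)
    (cong (λ b → (isMotzkinFrom h w ∧ b) ∧ (ascFrom false w ≡ᵇ k)) (below h<m (boundedFrom m h w)))))
    where
    reset : ∀ f w → Walk m (suc h) f k (D ∷ w) ≡ Walk m (suc h) false k (D ∷ w)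
    reset true  w = refl
    reset false w = refl

  walks-recurrence : ∀ m → Recurrence m (walks m)
  walks-recurrence m = record { vanish = vanish ; initial = initial ; step = step }
    where
    vanish : ∀ h f n k → m < h → walks m h f n k ≡ ℤ.+ 0
    vanish h f n k m<h = cong ℤ.+_ (Eq.trans (count-cong (words n) never) (count-false (words n)))
      where
      never : ∀ w → Walk m h f k w ≡ false
      never w = Eq.trans (cong (λ b → (isMotzkinFrom h w ∧ b) ∧ (ascFrom f w ≡ᵇ k)) (bounded-above w m<h))
                         (cong (_∧ (ascFrom f w ≡ᵇ k)) (∧-zeroʳ (isMotzkinFrom h w)))

    initial : ∀ h f k → h ≤ m → walks m h f 0 k ≡ δ h 0 k
    initial zero    f zero    _ = refl
    initial zero    f (suc k) _ = refl
    initial (suc h) f k       _ = refl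

    step : ∀ h f n k → h ≤ m →
           walks m h f (suc n) k ≡ up f (walks m (suc h) true) n k ℤ.+ walks m h false n k ℤ.+ down h (walks m) n k
    step h f n k h≤m = begin
      ℤ.+ count (Walk m h f k) (words (suc n))
        ≡⟨ cong ℤ.+_ (count-words (Walk m h f k) n) ⟩
      ℤ.+ (#U ℕ.+ #F ℕ.+ #D)
        ≡⟨ Eq.trans (ℤₚ.pos-+ (#U ℕ.+ #F) #D) (cong (ℤ._+ ℤ.+ #D) (ℤₚ.pos-+ #U #F)) ⟩
      ℤ.+ #U ℤ.+ ℤ.+ #F ℤ.+ ℤ.+ #D
        ≡⟨ cong₂ (λ u d → u ℤ.+ ℤ.+ #F ℤ.+ d) (first-U h≤m f k n) (first-D h h≤m f k n) ⟩
      up f (walks m (suc h) true) n k ℤ.+ ℤ.+ #F ℤ.+ down h (walks m) n k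
        ≡⟨ cong (λ z → up f (walks m (suc h) true) n k ℤ.+ ℤ.+ z ℤ.+ down h (walks m) n k) (first-F h≤m f k n) ⟩
      up f (walks m (suc h) true) n k ℤ.+ walks m h false n k ℤ.+ down h (walks m) n k ∎
      where
      #U #F #D : ℕ
      #U = count (λ w → Walk m h f k (U ∷ w)) (words n)
      #F = count (λ w → Walk m h f k (F ∷ w)) (words n)
      #D = count (λ w → Walk m h f k (D ∷ w)) (words n)

-- An explicit solution of the transfer equations for height bound m:
--   Y(h,false)   = x^h P_{m-h} / P_{m+1},
--   Y(h+1,true)  = x^h Q_{m-h} / P_{m+1},
--   Y(0,true)    = (P_{m+1} + x Q_m + x P_m) / P_{m+1},
-- where Q_0 = 0 and Q_{j+1} = x P_{j+1} + x² P_j + x² Q_j.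
module ExplicitSolution where
  open SeriesRing
  open ContinuedFraction using (P*invP)
  open TransferSystem
  open Counting using (≤ᵇ-true; ≤ᵇ-false)
  open import Data.Nat as ℕ using (zero; _∸_; _<_; _≤ᵇ_; z≤n; s≤s)
  import Data.Nat.Properties as ℕₚ
  open import Data.Integer using (_+_)
  open import Data.Bool using (Bool; true; false; if_then_else_)
  open import Relation.Nullary using (yes; no)
  import Relation.Binary.PropositionalEquality as Eq
  open Eq using (refl; cong; cong₂)
  open import Relation.Binary.Reasoning.Setoid seriesSetoid

  xPow : ℕ → Series
  xPow zero    = 1ₛ
  xPow (suc h) = xₛ *ₛ xPow h

  -- Q_0 is written as the constant ι 0 so that the solver treats it as 0
  Q : ℕ → Series
  Q zero    = ι (+ 0)
  Q (suc j) = xₛ *ₛ Pₛ (suc j) +ₛ xₛ *ₛ xₛ *ₛ Pₛ j +ₛ xₛ *ₛ xₛ *ₛ Q j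

  -- the identity to which every equation of the system reduces
  P-Q-identity : ∀ j → Pₛ (suc j) +ₛ xₛ *ₛ Pₛ j +ₛ xₛ *ₛ tₛ *ₛ Q j ≈ₛ Pₛ j
  P-Q-identity zero    = solve 2 (λ x t → (con (+ 1) :- x) :+ x :* con (+ 1) :+ x :* t :* con (+ 0) := con (+ 1)) ≈-refl xₛ tₛ
  P-Q-identity (suc j) = ≈-modulo (Pₛ (suc j)) (xₛ *ₛ xₛ) (Pₛ (suc j) +ₛ xₛ *ₛ Pₛ j +ₛ xₛ *ₛ tₛ *ₛ Q j) (Pₛ j)
    (solve 5 (λ x t p₁ p₀ q →
       ((con (+ 1) :- x :- x :* x :* (t :- con (+ 1))) :* p₁ :- (x :* x :+ x :* x :* x :* (t :- con (+ 1))) :* p₀)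
         :+ x :* p₁ :+ x :* t :* (x :* p₁ :+ x :* x :* p₀ :+ x :* x :* q)
       := p₁ :+ (x :* x) :* (p₁ :+ x :* p₀ :+ x :* t :* q :- p₀))
       ≈-refl xₛ tₛ (Pₛ (suc j)) (Pₛ j) (Q j))
    (P-Q-identity j)

  ≡⇒≈ : ∀ {f g} → f ≡ g → f ≈ₛ g
  ≡⇒≈ refl = ≈-refl

  x*-cong : ∀ {f g} → f ≈ₛ g → xₛ *ₛ f ≈ₛ xₛ *ₛ g
  x*-cong {f} {g} = *ₛ-cong {xₛ} {xₛ} {f} {g} ≈-refl

  t*-cong : ∀ {f g} → f ≈ₛ g → tₛ *ₛ f ≈ₛ tₛ *ₛ g
  t*-cong {f} {g} = *ₛ-cong {tₛ} {tₛ} {f} {g} ≈-refl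

  +₄-cong : ∀ {a a' b b' c c' d d'} → a ≈ₛ a' → b ≈ₛ b' → c ≈ₛ c' → d ≈ₛ d' →
            a +ₛ b +ₛ c +ₛ d ≈ₛ a' +ₛ b' +ₛ c' +ₛ d'
  +₄-cong e₁ e₂ e₃ e₄ n k = cong₂ _+_ (cong₂ _+_ (cong₂ _+_ (e₁ n k) (e₂ n k)) (e₃ n k)) (e₄ n k)

  0ₛ≈ι0 : 0ₛ ≈ₛ ι (+ 0)
  0ₛ≈ι0 zero    zero    = refl
  0ₛ≈ι0 zero    (suc k) = refl
  0ₛ≈ι0 (suc n) k       = refl

  ∸-split : ∀ m h → suc h ≤ m → m ∸ h ≡ suc (m ∸ suc h)
  ∸-split (suc m) zero    _         = refl
  ∸-split (suc m) (suc h) (s≤s h<m) = ∸-split m h h<m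

  module _ (m : ℕ) where
    I : Series
    I = invₛ (Pₛ (suc m))

    closed : ℕ → Bool → Series
    closed h       false = xPow h *ₛ Pₛ (m ∸ h) *ₛ I
    closed zero    true  = (Pₛ (suc m) +ₛ xₛ *ₛ Q m +ₛ xₛ *ₛ Pₛ m) *ₛ I
    closed (suc h) true  = xPow h *ₛ Q (m ∸ h) *ₛ I

    solution : Family
    solution h f = if h ≤ᵇ m then closed h f else 0ₛ

    solution-inside : ∀ h f → h ≤ m → solution h f ≡ closed h f
    solution-inside h f h≤m rewrite ≤ᵇ-true h≤m = refl

    solution-outside : ∀ h f → m < h → solution h f ≡ 0ₛ
    solution-outside h f m<h rewrite ≤ᵇ-false m<h = refl

    -- the closed form of Y(h+1,true) also holds at the boundary h = m, as Q_0 = 0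
    solution-true : ∀ h → h ≤ m → solution (suc h) true ≈ₛ xPow h *ₛ Q (m ∸ h) *ₛ I
    solution-true h h≤m with suc h ℕ.≤? m
    ... | yes h<m = ≡⇒≈ (solution-inside (suc h) true h<m)
    ... | no  h≮m = begin
      solution (suc h) true       ≈⟨ ≡⇒≈ (solution-outside (suc h) true (ℕₚ.≰⇒> h≮m)) ⟩
      0ₛ                          ≈⟨ 0ₛ≈ι0 ⟩
      ι (+ 0)                     ≈⟨ solve 2 (λ X I → con (+ 0) := X :* con (+ 0) :* I) ≈-refl (xPow h) I ⟩
      xPow h *ₛ Q 0 *ₛ I          ≈⟨ ≡⇒≈ (cong (λ j → xPow h *ₛ Q j *ₛ I) (Eq.sym (ℕₚ.m≤n⇒m∸n≡0 (ℕₚ.≤-pred (ℕₚ.≰⇒> h≮m))))) ⟩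
      xPow h *ₛ Q (m ∸ h) *ₛ I ∎

    rhs : ℕ → Bool → Series
    rhs h f = δ h +ₛ xₛ *ₛ up f (solution (suc h) true) +ₛ xₛ *ₛ solution h false +ₛ xₛ *ₛ down h solution

    rhs-zero-false : rhs 0 false ≈ₛ solution 0 false
    rhs-zero-false = begin
      1ₛ +ₛ xₛ *ₛ (tₛ *ₛ solution 1 true) +ₛ xₛ *ₛ solution 0 false +ₛ xₛ *ₛ 0ₛ
        ≈⟨ +₄-cong (≈-sym (P*invP (suc m))) (x*-cong (t*-cong (solution-true 0 z≤n))) ≈-refl (x*-cong 0ₛ≈ι0) ⟩
      Pₛ (suc m) *ₛ I +ₛ xₛ *ₛ (tₛ *ₛ (1ₛ *ₛ Q m *ₛ I)) +ₛ xₛ *ₛ (1ₛ *ₛ Pₛ m *ₛ I) +ₛ xₛ *ₛ ι (+ 0)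
        ≈⟨ ≈-modulo (1ₛ *ₛ Pₛ m *ₛ I) I (Pₛ (suc m) +ₛ xₛ *ₛ Pₛ m +ₛ xₛ *ₛ tₛ *ₛ Q m) (Pₛ m)
             (solve 6 (λ x t p₁ p₀ q i →
                p₁ :* i :+ x :* (t :* (con (+ 1) :* q :* i)) :+ x :* (con (+ 1) :* p₀ :* i) :+ x :* con (+ 0)
                := con (+ 1) :* p₀ :* i :+ i :* (p₁ :+ x :* p₀ :+ x :* t :* q :- p₀))
                ≈-refl xₛ tₛ (Pₛ (suc m)) (Pₛ m) (Q m) I)
             (P-Q-identity m) ⟩
      1ₛ *ₛ Pₛ m *ₛ I ∎

    rhs-zero-true : rhs 0 true ≈ₛ solution 0 true
    rhs-zero-true = begin
      1ₛ +ₛ xₛ *ₛ solution 1 true +ₛ xₛ *ₛ solution 0 false +ₛ xₛ *ₛ 0ₛ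
        ≈⟨ +₄-cong (≈-sym (P*invP (suc m))) (x*-cong (solution-true 0 z≤n)) ≈-refl (x*-cong 0ₛ≈ι0) ⟩
      Pₛ (suc m) *ₛ I +ₛ xₛ *ₛ (1ₛ *ₛ Q m *ₛ I) +ₛ xₛ *ₛ (1ₛ *ₛ Pₛ m *ₛ I) +ₛ xₛ *ₛ ι (+ 0)
        ≈⟨ solve 5 (λ x p₁ p₀ q i →
              p₁ :* i :+ x :* (con (+ 1) :* q :* i) :+ x :* (con (+ 1) :* p₀ :* i) :+ x :* con (+ 0)
              := (p₁ :+ x :* q :+ x :* p₀) :* i)
              ≈-refl xₛ (Pₛ (suc m)) (Pₛ m) (Q m) I ⟩
      (Pₛ (suc m) +ₛ xₛ *ₛ Q m +ₛ xₛ *ₛ Pₛ m) *ₛ I ∎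

    module _ (h : ℕ) (h<m : suc h ≤ m) where
      private
        j : ℕ
        j = m ∸ suc h
        X : Series
        X = xPow h
        below-false : solution h false ≈ₛ X *ₛ Pₛ (suc j) *ₛ I
        below-false = ≡⇒≈ (Eq.trans (solution-inside h false (ℕₚ.≤-trans (ℕₚ.n≤1+n h) h<m))
                                    (cong (λ i → X *ₛ Pₛ i *ₛ I) (∸-split m h h<m)))

      rhs-suc-false : rhs (suc h) false ≈ₛ solution (suc h) false
      rhs-suc-false = begin
        0ₛ +ₛ xₛ *ₛ (tₛ *ₛ solution (suc (suc h)) true) +ₛ xₛ *ₛ solution (suc h) false +ₛ xₛ *ₛ solution h false
          ≈⟨ +₄-cong 0ₛ≈ι0 (x*-cong (t*-cong (solution-true (suc h) h<m)))
                     (x*-cong (≡⇒≈ (solution-inside (suc h) false h<m))) (x*-cong below-false) ⟩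
        ι (+ 0) +ₛ xₛ *ₛ (tₛ *ₛ (xₛ *ₛ X *ₛ Q j *ₛ I)) +ₛ xₛ *ₛ (xₛ *ₛ X *ₛ Pₛ j *ₛ I) +ₛ xₛ *ₛ (X *ₛ Pₛ (suc j) *ₛ I)
          ≈⟨ ≈-modulo (xₛ *ₛ X *ₛ Pₛ j *ₛ I) (xₛ *ₛ X *ₛ I) (Pₛ (suc j) +ₛ xₛ *ₛ Pₛ j +ₛ xₛ *ₛ tₛ *ₛ Q j) (Pₛ j)
               (solve 7 (λ x t X p₁ p₀ q i →
                  con (+ 0) :+ x :* (t :* (x :* X :* q :* i)) :+ x :* (x :* X :* p₀ :* i) :+ x :* (X :* p₁ :* i)
                  := x :* X :* p₀ :* i :+ x :* X :* i :* (p₁ :+ x :* p₀ :+ x :* t :* q :- p₀))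
                  ≈-refl xₛ tₛ X (Pₛ (suc j)) (Pₛ j) (Q j) I)
               (P-Q-identity j) ⟩
        xₛ *ₛ X *ₛ Pₛ j *ₛ I
          ≈⟨ ≈-sym (≡⇒≈ (solution-inside (suc h) false h<m)) ⟩
        solution (suc h) false ∎

      rhs-suc-true : rhs (suc h) true ≈ₛ solution (suc h) true
      rhs-suc-true = begin
        0ₛ +ₛ xₛ *ₛ solution (suc (suc h)) true +ₛ xₛ *ₛ solution (suc h) false +ₛ xₛ *ₛ solution h false
          ≈⟨ +₄-cong 0ₛ≈ι0 (x*-cong (solution-true (suc h) h<m))
                     (x*-cong (≡⇒≈ (solution-inside (suc h) false h<m))) (x*-cong below-false) ⟩
        ι (+ 0) +ₛ xₛ *ₛ (xₛ *ₛ X *ₛ Q j *ₛ I) +ₛ xₛ *ₛ (xₛ *ₛ X *ₛ Pₛ j *ₛ I) +ₛ xₛ *ₛ (X *ₛ Pₛ (suc j) *ₛ I)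
          ≈⟨ solve 6 (λ x X p₁ p₀ q i →
                con (+ 0) :+ x :* (x :* X :* q :* i) :+ x :* (x :* X :* p₀ :* i) :+ x :* (X :* p₁ :* i)
                := X :* (x :* p₁ :+ x :* x :* p₀ :+ x :* x :* q) :* i)
                ≈-refl xₛ X (Pₛ (suc j)) (Pₛ j) (Q j) I ⟩
        X *ₛ Q (suc j) *ₛ I
          ≈⟨ ≡⇒≈ (cong (λ i → X *ₛ Q i *ₛ I) (Eq.sym (∸-split m h h<m))) ⟩
        X *ₛ Q (m ∸ h) *ₛ I
          ≈⟨ ≈-sym (≡⇒≈ (solution-inside (suc h) true h<m)) ⟩
        solution (suc h) true ∎

    solution-equations : Equations m solution
    solution-equations = record
      { vanish   = λ h f n k m<h → cong (λ S → S n k) (solution-outside h f m<h)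
      ; equation = λ h f h≤m → ≈-sym (rhs≈solution h f h≤m) }
      where
      rhs≈solution : ∀ h f → h ≤ m → rhs h f ≈ₛ solution h f
      rhs≈solution zero    false _   = rhs-zero-false
      rhs≈solution zero    true  _   = rhs-zero-true
      rhs≈solution (suc h) false h<m = rhs-suc-false h h<m
      rhs≈solution (suc h) true  h<m = rhs-suc-true h h<m

module Limit where
  open SeriesRing
  open Inverse using (invₛ-inverse)
  open ContinuedFraction using (quotient≈CF; ConstOne-a-bW)
  open TransferSystem using (recurrence-unique; equations⇒recurrence)
  open Counting using (walks; walks-recurrence; Fasc-bounded≈walks; Fasc-bounded-short)
  open ExplicitSolution using (solution-equations)
  open import Data.Nat using (_∸_)
  import Data.Nat.Properties as ℕₚ
  open import Data.Integer using (_*_; _-_)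
  open import Data.Bool using (false)
  open import Data.Product using (_,_)
  import Relation.Binary.PropositionalEquality as Eq
  open Eq using (refl; cong₂)
  open import Relation.Binary.Reasoning.Setoid seriesSetoid

  -- the walks and the explicit solution solve the same recurrence
  Fasc-bounded≈quotient : ∀ m → Fasc-bounded m ≈ₛ Pₛ m *ₛ invₛ (Pₛ (suc m))
  Fasc-bounded≈quotient m =
    Fasc-bounded≈walks m
    ⟨≈⟩ (λ n k → recurrence-unique (walks-recurrence m) (equations⇒recurrence (solution-equations m)) n 0 false k)
    ⟨≈⟩ solve 2 (λ p i → con (+ 1) :* p :* i := p :* i) ≈-refl (Pₛ m) (invₛ (Pₛ (suc m)))

  Fasc-bounded≈CF : ∀ m → Fasc-bounded m ≈ₛ CF m
  Fasc-bounded≈CF m = Fasc-bounded≈quotient m ⟨≈⟩ quotient≈CF m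

  CF-agrees : ∀ m n k → n ≤ m → CF m n k ≡ Fasc n k
  CF-agrees m n k n≤m = Eq.trans (Eq.sym (Fasc-bounded≈CF m n k)) (Fasc-bounded-short m n k n≤m)

  CF-converges : ConvergesTo CF Fasc
  CF-converges N = N , λ m N≤m n n≤N k → CF-agrees m n k (ℕₚ.≤-trans n≤N N≤m)

  _≈[≤_]_ : Series → ℕ → Series → Set
  f ≈[≤ N ] g = ∀ n → n ≤ N → ∀ k → f n k ≡ g n k

  sumTo-cong≤ : ∀ n {f g} → (∀ i → i ≤ n → f i ≡ g i) → sumTo n f ≡ sumTo n g
  sumTo-cong≤ n {f} {g} e = Eq.trans (sumTo≡∑ n f) (Eq.trans (ℤ[[t]].∑-cong≤ n e) (Eq.sym (sumTo≡∑ n g)))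

  *-agree : ∀ {N} f f' g g' → f ≈[≤ N ] f' → g ≈[≤ N ] g' → (f *ₛ g) ≈[≤ N ] (f' *ₛ g')
  *-agree f f' g g' f≈f' g≈g' n n≤N k = sumTo-cong≤ n (λ i i≤n → sumTo-cong≤ k (λ j _ →
    cong₂ _*_ (f≈f' i (ℕₚ.≤-trans i≤n n≤N) j) (g≈g' (n ∸ i) (ℕₚ.≤-trans (ℕₚ.m∸n≤m n i) n≤N) (k ∸ j))))

  -- passing to the limit in CF (m+1) (a - b CF m) = 1
  Fasc-equation : Fasc *ₛ (aₛ -ₛ bₛ *ₛ Fasc) ≈ₛ 1ₛ
  Fasc-equation n k = Eq.trans (close n ℕₚ.≤-refl k) (CF-equation n n k)
    where
    CF-equation : ∀ m → CF (suc m) *ₛ (aₛ -ₛ bₛ *ₛ CF m) ≈ₛ 1ₛ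
    CF-equation m = CommutativeRing.*-comm seriesRing (CF (suc m)) (aₛ -ₛ bₛ *ₛ CF m)
                    ⟨≈⟩ invₛ-inverse (aₛ -ₛ bₛ *ₛ CF m) (ConstOne-a-bW (CF m))
    close : (Fasc *ₛ (aₛ -ₛ bₛ *ₛ Fasc)) ≈[≤ n ] (CF (suc n) *ₛ (aₛ -ₛ bₛ *ₛ CF n))
    close = *-agree Fasc (CF (suc n)) (aₛ -ₛ bₛ *ₛ Fasc) (aₛ -ₛ bₛ *ₛ CF n)
      (λ n' n'≤n k → Eq.sym (CF-agrees (suc n) n' k (ℕₚ.m≤n⇒m≤1+n n'≤n)))
      (λ n' n'≤n k → cong₂ _-_ (refl {x = aₛ n' k})
         (*-agree bₛ bₛ Fasc (CF n) (λ _ _ _ → refl) (λ n'' n''≤n k' → Eq.sym (CF-agrees n n'' k' n''≤n)) n' n'≤n k))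

  -- the discriminant of b F² - a F + 1
  Δ≈a²-4b : Δₛ ≈ₛ aₛ *ₛ aₛ -ₛ (bₛ +ₛ bₛ +ₛ bₛ +ₛ bₛ)
  Δ≈a²-4b = solve 2 (λ x t →
      con (+ 1) :- (x :+ x) :- x :* x :* (t :+ t :+ con (+ 1))
      :- (x :* x :* x :* (t :- con (+ 1)) :+ x :* x :* x :* (t :- con (+ 1)))
      :+ x :* x :* x :* x :* (t :- con (+ 1)) :* (t :- con (+ 1))
    := (con (+ 1) :- x :- x :* x :* (t :- con (+ 1))) :* (con (+ 1) :- x :- x :* x :* (t :- con (+ 1)))
       :- ((x :* x :+ x :* x :* x :* (t :- con (+ 1))) :+ (x :* x :+ x :* x :* x :* (t :- con (+ 1)))
          :+ (x :* x :+ x :* x :* x :* (t :- con (+ 1))) :+ (x :* x :+ x :* x :* x :* (t :- con (+ 1)))))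
    ≈-refl xₛ tₛ

  -- the square root of Δ in the closed form of F^asc
  root : Series
  root = aₛ -ₛ (bₛ +ₛ bₛ) *ₛ Fasc

  -- the branch of the square root with constant term 1
  root-constant : root 0 0 ≡ + 1
  root-constant = refl

  root-squared : root *ₛ root ≈ₛ Δₛ
  root-squared = begin
    root *ₛ root
      ≈⟨ ≈-modulo (aₛ *ₛ aₛ -ₛ (bₛ +ₛ bₛ +ₛ bₛ +ₛ bₛ)) (negₛ (bₛ +ₛ bₛ +ₛ bₛ +ₛ bₛ)) (Fasc *ₛ (aₛ -ₛ bₛ *ₛ Fasc)) 1ₛ
           (solve 3 (λ a b F →
              (a :- (b :+ b) :* F) :* (a :- (b :+ b) :* F)
              := a :* a :- (b :+ b :+ b :+ b) :+ (:- (b :+ b :+ b :+ b)) :* (F :* (a :- b :* F) :- con (+ 1)))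
              ≈-refl aₛ bₛ Fasc)
           Fasc-equation ⟩
    aₛ *ₛ aₛ -ₛ (bₛ +ₛ bₛ +ₛ bₛ +ₛ bₛ)
      ≈⟨ ≈-sym Δ≈a²-4b ⟩
    Δₛ ∎

  -- i.e. F^asc = (a - root)/(2b)
  2bFasc≈a-root : (bₛ +ₛ bₛ) *ₛ Fasc ≈ₛ aₛ -ₛ root
  2bFasc≈a-root = solve 2 (λ a c → c := a :- (a :- c)) ≈-refl aₛ ((bₛ +ₛ bₛ) *ₛ Fasc)

open ContinuedFraction using (quotient≈CF)
open Limit using (Fasc-bounded≈quotient; CF-converges; root; root-constant; root-squared; 2bFasc≈a-root)

-- The bounded statements hold for every m, in particular for m ≥ 1.
theorem6 : ((m : ℕ) → 1 ≤ m →
              (Fasc-bounded m ≈ₛ Pₛ m *ₛ invₛ (Pₛ (suc m)))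
              × (Pₛ m *ₛ invₛ (Pₛ (suc m)) ≈ₛ CF m))
           × ConvergesTo CF Fasc
           × (∃ λ S → (S 0 0 ≡ + 1) × (S *ₛ S ≈ₛ Δₛ)
                × ((bₛ +ₛ bₛ) *ₛ Fasc ≈ₛ aₛ -ₛ S))
theorem6 =
  (λ m _ → Fasc-bounded≈quotient m , quotient≈CF m) ,
  CF-converges ,
  (root , root-constant , root-squared , 2bFasc≈a-root)
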